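{- Let $f:H\to H'$ be a morphism of valued hyperfields and let $x,y\in H$. Then $d(f(x),f(y))\le d(x,y)$, with equality if $f(x)\neq f(y)$.
   Context: A hyperfield is a set $H$ with a multivalued addition $+:H\times H\to 2^H$ and a single-valued multiplication such that: $(x+y)+z=x+(y+z)$ for all $x,y,z$, where $(x+y)+z:=\bigcup_{t\in x+y}(t+z)$ and similarly on the right; $x+y=y+x$; there is $0\in H$ with $x+0=\{x\}$ for all $x$; for every $x$ there is a unique $-x$ with $0\in x+(-x)$; $x\in y-z$ iff $y\in x+z$ (where $y-z:=y+(-z)$); multiplication is commutative, associative, unital, with $(x+y)z\subseteq xz+yz$; $0\neq 1$ and every nonzero element is invertible. For subsets, $A+B=\bigcup_{a\in A,b\in B}(a+b)$. A valued hyperfield is a hyperfield with a map $|\cdot|:H\to\mathbb{R}$ such that (i) $|x|\ge0$ with equality iff $x=0$; (ii) $|xy|=|x||y|$; (iii) $|z|\le\max(|x|,|y|)$ for all $z\in x+y$; (iv) $|\cdot|$ is constant on $x+y$ unless $0\in x+y$; the metric is $d(x,y)=|z|$ for any $z\in x-y$ when $x\neq y$, and $d(x,x)=0$; (v) there is a real $\rho>0$ such that either $x+y$ is a closed ball of radius $\rho\max(|x|,|y|)$ for all $x,y$, or $x+y$ is an open ball of radius $\rho\max(|x|,|y|)$ for all $x,y$. A morphism of valued hyperfields $f:H_1\to H_2$ is a map with $f(xy)=f(x)f(y)$, $f^{ -1}(a+b)=f^{ -1}(a)+f^{ -1}(b)$ for all $a,b\in f(H_1)$, $|f(x)|=|x|$,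 and $f^{ -1}(1)$ a ball. -}

module Defs where

open import Level using (0ℓ)
open import Data.Product using (Σ; ∃; _×_; _,_)
open import Data.Sum using (_⊎_)
open import Relation.Nullary using (¬_; yes; no)
open import Relation.Binary.PropositionalEquality using (_≡_)
open import Relation.Binary.Structures using (IsDecTotalOrder)
open import Algebra.Structures using (IsCommutativeRing)

infix 2 _⟺_
_⟺_ : Set → Set → Set
A ⟺ B = (A → B) × (B → A)

-- The real numbers, axiomatised as a complete ordered field
-- (any model is isomorphic to ℝ).  The stdlib has no reals.

record Reals : Set₁ where
  infixl 6 _+_
  infixl 7 _*_
  infix  4 _≤_ _<_
  field
    ℝ    : Set
    _+_  : ℝ → ℝ → ℝ
    _*_  : ℝ → ℝ → ℝ
    -_   : ℝ → ℝ
    0ℝ   : ℝ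
    1ℝ   : ℝ
    _≤_  : ℝ → ℝ → Set
    isCommutativeRing : IsCommutativeRing _≡_ _+_ _*_ -_ 0ℝ 1ℝ
    isDecTotalOrder   : IsDecTotalOrder _≡_ _≤_
    0≢1        : ¬ (0ℝ ≡ 1ℝ)
    inverse    : ∀ a → ¬ (a ≡ 0ℝ) → ∃ λ b → a * b ≡ 1ℝ
    +-mono-≤   : ∀ a b c → a ≤ b → a + c ≤ b + c
    *-nonneg   : ∀ a b → 0ℝ ≤ a → 0ℝ ≤ b → 0ℝ ≤ a * b
    complete   : (P : ℝ → Set) → (∃ λ x → P x) → (∃ λ u → ∀ x → P x → x ≤ u) →
                 ∃ λ s → (∀ x → P x → x ≤ s) × (∀ u → (∀ x → P x → x ≤ u) → s ≤ u)

  _<_ : ℝ → ℝ → Set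
  a < b = (a ≤ b) × ¬ (a ≡ b)

  max : ℝ → ℝ → ℝ
  max a b with IsDecTotalOrder._≤?_ isDecTotalOrder a b
  ... | yes _ = b
  ... | no  _ = a

-- Hyperfields.  A subset of H is a predicate; x ⊞ y is the predicate
-- "z ∈ x + y" written  z ∈[ x ⊞ y ].

record Hyperfield : Set₁ where
  infix 4 _∈[_⊞_]
  field
    H      : Set
    _∈[_⊞_] : H → H → H → Set
    0H     : H
    1H     : H
    neg    : H → H
    _·_    : H → H → H
    ⊞-assoc : ∀ x y z w →
      (∃ λ t → t ∈[ x ⊞ y ] × w ∈[ t ⊞ z ]) ⟺ (∃ λ t → t ∈[ y ⊞ z ] × w ∈[ x ⊞ t ])
    ⊞-comm  : ∀ x y w → w ∈[ x ⊞ y ] ⟺ w ∈[ y ⊞ x ]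
    ⊞-zero  : ∀ x w → w ∈[ x ⊞ 0H ] ⟺ (w ≡ x)
    neg-inv    : ∀ x → 0H ∈[ x ⊞ neg x ]
    neg-unique : ∀ x y → 0H ∈[ x ⊞ y ] → y ≡ neg x
    reversible : ∀ x y z → x ∈[ y ⊞ neg z ] ⟺ y ∈[ x ⊞ z ]
    ·-comm  : ∀ x y → x · y ≡ y · x
    ·-assoc : ∀ x y z → (x · y) · z ≡ x · (y · z)
    ·-unit  : ∀ x → 1H · x ≡ x
    distrib : ∀ x y z w → w ∈[ x ⊞ y ] → (w · z) ∈[ (x · z) ⊞ (y · z) ]
    0≢1     : ¬ (0H ≡ 1H)
    invertible : ∀ x → ¬ (x ≡ 0H) → ∃ λ y → x · y ≡ 1H

module _ (R : Reals) where
  open Reals R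

  module HyperMetric (K : Hyperfield) (abs : Hyperfield.H K → ℝ) where
    open Hyperfield K

    IsDist : H → H → ℝ → Set
    IsDist x y δ = (x ≡ y × δ ≡ 0ℝ) ⊎ (¬ (x ≡ y) × ∃ λ z → z ∈[ x ⊞ neg y ] × δ ≡ abs z)

    InClosedBall : H → ℝ → H → Set
    InClosedBall c r w = ∃ λ δ → IsDist w c δ × δ ≤ r

    InOpenBall : H → ℝ → H → Set
    InOpenBall c r w = ∃ λ δ → IsDist w c δ × δ < r

    IsClosedBall : (H → Set) → H → ℝ → Set
    IsClosedBall S c r = ∀ w → S w ⟺ InClosedBall c r w

    IsOpenBall : (H → Set) → H → ℝ → Set
    IsOpenBall S c r = ∀ w → S w ⟺ InOpenBall c r w

    IsBall : (H → Set) → Set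
    IsBall S = ∃ λ c → ∃ λ r → IsClosedBall S c r ⊎ IsOpenBall S c r

  record ValuedHyperfield : Set₁ where
    field
      hf  : Hyperfield
    open Hyperfield hf
    field
      ∣_∣ : H → ℝ
    open HyperMetric hf ∣_∣
    field
      abs-nonneg : ∀ x → 0ℝ ≤ ∣ x ∣
      abs-zero   : ∀ x → (∣ x ∣ ≡ 0ℝ) ⟺ (x ≡ 0H)
      abs-mult   : ∀ x y → ∣ x · y ∣ ≡ ∣ x ∣ * ∣ y ∣
      abs-ultra  : ∀ x y z → z ∈[ x ⊞ y ] → ∣ z ∣ ≤ max ∣ x ∣ ∣ y ∣
      abs-const  : ∀ x y z z' → ¬ (0H ∈[ x ⊞ y ]) → z ∈[ x ⊞ y ] → z' ∈[ x ⊞ y ] →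
                   ∣ z ∣ ≡ ∣ z' ∣
      balls      : ∃ λ ρ → (0ℝ < ρ) ×
        ( (∀ x y → ∃ λ c → IsClosedBall (λ w → w ∈[ x ⊞ y ]) c (ρ * max ∣ x ∣ ∣ y ∣))
        ⊎ (∀ x y → ∃ λ c → IsOpenBall   (λ w → w ∈[ x ⊞ y ]) c (ρ * max ∣ x ∣ ∣ y ∣)))

    open HyperMetric hf ∣_∣ public

  record Morphism (K L : ValuedHyperfield) : Set where
    module K = ValuedHyperfield K
    module L = ValuedHyperfield L
    open Hyperfield using (H; _∈[_⊞_])
    field
      f : H K.hf → H L.hf
      f-mult : ∀ x y → f (Hyperfield._·_ K.hf x y) ≡ Hyperfield._·_ L.hf (f x) (f y)
      -- f⁻¹(a + b) = f⁻¹(a) + f⁻¹(b) for a = f u, b = f v in the image of f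
      f-preimage : ∀ u v x →
        _∈[_⊞_] L.hf (f x) (f u) (f v) ⟺
        (∃ λ s → ∃ λ t → f s ≡ f u × f t ≡ f v × _∈[_⊞_] K.hf x s t)
      f-abs : ∀ x → L.∣ f x ∣ ≡ K.∣ x ∣
      f-ball : K.IsBall (λ x → f x ≡ Hyperfield.1H L.hf)

-- A morphism maps x − y into f x − f y and preserves absolute values, so
-- whenever f x ≠ f y the distance |z| (z ∈ x − y) is also a distance
-- between f x and f y; it is the only one, since | · | is constant on
-- f x − f y (which does not contain 0).
module Submission where

open import Defs
open import Data.Product using (_×_; _,_; proj₁; proj₂)
open import Data.Sum using (inj₁; inj₂)
open import Data.Empty using (⊥-elim)
open import Relation.Nullary using (¬_)
open import Relation.Binary.PropositionalEquality using (_≡_; refl; sym; trans; subst)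
open import Relation.Binary.Structures using (IsDecTotalOrder)

module HyperfieldProperties (K : Hyperfield) where
  open Hyperfield K

  0∈x-y⇒x≡y : ∀ x y → 0H ∈[ x ⊞ neg y ] → x ≡ y
  0∈x-y⇒x≡y x y 0∈x-y =
    proj₁ (⊞-zero y x) (proj₁ (⊞-comm 0H y x) (proj₁ (reversible 0H x y) 0∈x-y))

module ValuedHyperfieldProperties (R : Reals) (K : ValuedHyperfield R) where
  open Reals R using (_≤_; 0ℝ; isDecTotalOrder)
  open ValuedHyperfield K
  open Hyperfield hf
  open HyperfieldProperties hf

  IsDist-nonneg : ∀ {x y δ} → IsDist x y δ → 0ℝ ≤ δ
  IsDist-nonneg (inj₁ (_ , refl))          = IsDecTotalOrder.refl isDecTotalOrder
  IsDist-nonneg (inj₂ (_ , z , _ , refl)) = abs-nonneg z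

  IsDist-unique : ∀ {x y δ δ'} → IsDist x y δ → IsDist x y δ' → δ ≡ δ'
  IsDist-unique (inj₁ (_ , δ≡0)) (inj₁ (_ , δ'≡0)) = trans δ≡0 (sym δ'≡0)
  IsDist-unique (inj₁ (x≡y , _)) (inj₂ (x≢y , _)) = ⊥-elim (x≢y x≡y)
  IsDist-unique (inj₂ (x≢y , _)) (inj₁ (x≡y , _)) = ⊥-elim (x≢y x≡y)
  IsDist-unique {x} {y} (inj₂ (x≢y , z , hz , refl)) (inj₂ (_ , z' , hz' , refl)) =
    abs-const x (neg y) z z' (λ 0∈x-y → x≢y (0∈x-y⇒x≡y x y 0∈x-y)) hz hz'

module MorphismProperties (R : Reals) (K L : ValuedHyperfield R) (φ : Morphism R K L) where
  module K = ValuedHyperfield K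
  module L = ValuedHyperfield L
  module HK = Hyperfield K.hf
  module HL = Hyperfield L.hf
  open Morphism φ using (f; f-preimage; f-abs)

  f-0 : f HK.0H ≡ HL.0H
  f-0 = proj₁ (L.abs-zero (f HK.0H)) (trans (f-abs HK.0H) (proj₂ (K.abs-zero HK.0H) refl))

  f-⊞ : ∀ {a b c} → HK._∈[_⊞_] c a b → HL._∈[_⊞_] (f c) (f a) (f b)
  f-⊞ {a} {b} {c} c∈a+b = proj₂ (f-preimage a b c) (a , b , refl , refl , c∈a+b)

  f-neg : ∀ y → f (HK.neg y) ≡ HL.neg (f y)
  f-neg y = HL.neg-unique (f y) (f (HK.neg y))
    (subst (λ o → HL._∈[_⊞_] o (f y) (f (HK.neg y))) f-0 (f-⊞ (HK.neg-inv y)))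

  f-∈-diff : ∀ {x y z} → HK._∈[_⊞_] z x (HK.neg y) → HL._∈[_⊞_] (f z) (f x) (HL.neg (f y))
  f-∈-diff {x} {y} {z} z∈x-y = subst (HL._∈[_⊞_] (f z) (f x)) (f-neg y) (f-⊞ z∈x-y)

  IsDist-map : ∀ {x y δ} → ¬ (f x ≡ f y) → K.IsDist x y δ → L.IsDist (f x) (f y) δ
  IsDist-map fx≢fy (inj₁ (refl , _))          = ⊥-elim (fx≢fy refl)
  IsDist-map fx≢fy (inj₂ (_ , z , hz , refl)) = inj₂ (fx≢fy , f z , f-∈-diff hz , sym (f-abs z))

lemma5p2 : (R : Reals) (K L : ValuedHyperfield R) (φ : Morphism R K L)
    (x y : Hyperfield.H (ValuedHyperfield.hf K)) (δ δ' : Reals.ℝ R) →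
    ValuedHyperfield.IsDist K x y δ →
    ValuedHyperfield.IsDist L (Morphism.f φ x) (Morphism.f φ y) δ' →
    Reals._≤_ R δ' δ × (¬ (Morphism.f φ x ≡ Morphism.f φ y) → δ' ≡ δ)
lemma5p2 R K L φ x y δ δ' dxy (inj₁ (fx≡fy , refl)) =
  ValuedHyperfieldProperties.IsDist-nonneg R K dxy , λ fx≢fy → ⊥-elim (fx≢fy fx≡fy)
lemma5p2 R K L φ x y δ δ' dxy dfxy@(inj₂ (fx≢fy , _)) =
  subst (Reals._≤_ R δ') δ'≡δ (IsDecTotalOrder.refl (Reals.isDecTotalOrder R)) , λ _ → δ'≡δ
  where
  δ'≡δ : δ' ≡ δ
  δ'≡δ = ValuedHyperfieldProperties.IsDist-unique R L dfxy
           (MorphismProperties.IsDist-map R K L φ fx≢fy dxy)
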